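{- Assume the set of atoms is finite. Let $E\in\mathcal{L}({\sf par})$ and let $\mathscr{K}$ be a stable, $E$-extendable class of Kripke models. Then for every $n>c(E)$, the class $\mathscr{K}^{\downarrow}_n:=\{\mathcal{K}:\exists\mathcal{K}'\in\mathscr{K}\ (\mathcal{K}\le_n\mathcal{K}')\}$ is also stable and $E$-extendable.
   Context: Formulas are built from atoms ${\sf atom}={\sf var}\cup{\sf par}$ (variables and parameters; ${\sf atom}$ finite) using $\bot,\wedge,\vee,\to$; $\mathcal{L}({\sf par})$ is the set of formulas whose atoms are all parameters. Kripke models are finite rooted intuitionistic Kripke models with persistent valuations; for a node $w$ of $\mathcal{K}$, $\mathcal{K}_w$ is the submodel of nodes accessible from $w$ (including $w$), and ${\rm Val}(\mathcal{K})$ is the set of atoms true at the root. The implication depth $c$: $c(a)=c(\bot)=0$ for atoms, $c(A\wedge B)=c(A\vee B)=\max(c(A),c(B))$, $c(A\to B)=1+\max(c(A),c(B))$. Relations: $\mathcal{K}\sim_0\mathcal{K}'$ iff ${\rm Val}(\mathcal{K})={\rm Val}(\mathcal{K}')$; $\mathcal{K}\sim_{n+1}\mathcal{K}'$ iff for every node $w$ of $\mathcal{K}$ there is a node $w'$ of $\mathcal{K}'$ with $\mathcal{K}_w\sim_n\mathcal{K}'_{w'}$ and for every $w'$ in $\mathcal{K}'$ there is $w$ in $\mathcal{K}$ with $\mathcal{K}_w\sim_n\mathcal{K}'_{w'}$; $\mathcal{K}\le_0\mathcal{K}'$ iff ${\rm Val}(\mathcal{K})\supseteq{\rm Val}(\mathcal{K}')$;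 $\mathcal{K}\le_{n+1}\mathcal{K}'$ iff for every node $w$ of $\mathcal{K}$ there is a node $w'$ of $\mathcal{K}'$ with $\mathcal{K}_w\sim_n\mathcal{K}'_{w'}$. A class $\mathscr{K}$ is stable if $\mathcal{K}\in\mathscr{K}$ implies $\mathcal{K}_w\in\mathscr{K}$ for every node $w$. A variant of $\mathcal{K}$ is a model with the same frame and the same valuation at all non-root nodes; a ${\sf par}$-variant additionally has the root force the same parameters. For a finite class $\mathscr{M}$ of models, $\sum\mathscr{M}$ is the disjoint union of the models in $\mathscr{M}$ with a fresh root added below, with empty valuation. A class $\mathscr{K}$ is $E$-extendable if every model in $\mathscr{K}$ forces $E$ everywhere, and for every finite (possibly empty) $\mathscr{M}\subseteq\mathscr{K}$, if a variant $\mathcal{K}$ of $\sum\mathscr{M}$ forces $E$, then some ${\sf par}$-variant of $\mathcal{K}$ belongs to $\mathscr{K}$. -}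

module Defs where

open import Level using (Level) renaming (_⊔_ to _⊔ℓ_)
open import Data.Nat using (ℕ; zero; suc; _⊔_; _<_)
open import Data.Fin using (Fin)
open import Data.Bool using (Bool; true; false; T; if_then_else_)
open import Data.Unit using (⊤; tt)
open import Data.Empty using (⊥; ⊥-elim)
open import Data.Sum using (_⊎_; inj₁; inj₂)
open import Data.Product using (Σ; _×_; _,_; proj₁; proj₂)
open import Data.Maybe using (Maybe; nothing; just)
open import Data.List using (List; []; _∷_; _++_; map)
open import Data.List.Membership.Propositional using (_∈_)
open import Data.List.Membership.Propositional.Properties using (∈-++⁺ˡ; ∈-++⁺ʳ; ∈-map⁺)
open import Data.List.Relation.Unary.Any using (here; there)
open import Data.List.Relation.Unary.All using (All)
open import Relation.Binary.PropositionalEquality using (_≡_; refl; sym; cong; subst)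
open import Relation.Nullary using (¬_)

-- Atoms: a finite set of variables (Fin nv) and parameters (Fin np).

Atom : ℕ → ℕ → Set
Atom nv np = Fin nv ⊎ Fin np

data Fm (nv np : ℕ) : Set where
  atm : Atom nv np → Fm nv np
  ⊥ᶠ : Fm nv np
  _∧ᶠ_ : Fm nv np → Fm nv np → Fm nv np
  _∨ᶠ_ : Fm nv np → Fm nv np → Fm nv np
  _⇒ᶠ_ : Fm nv np → Fm nv np → Fm nv np

c : ∀ {nv np} → Fm nv np → ℕ
c (atm _) = 0
c ⊥ᶠ = 0
c (A ∧ᶠ B) = c A ⊔ c B
c (A ∨ᶠ B) = c A ⊔ c B
c (A ⇒ᶠ B) = suc (c A ⊔ c B)

InLPar : ∀ {nv np} → Fm nv np → Set
InLPar (atm (inj₁ _)) = ⊥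
InLPar (atm (inj₂ _)) = ⊤
InLPar ⊥ᶠ = ⊤
InLPar (A ∧ᶠ B) = InLPar A × InLPar B
InLPar (A ∨ᶠ B) = InLPar A × InLPar B
InLPar (A ⇒ᶠ B) = InLPar A × InLPar B

-- Finite rooted intuitionistic Kripke models (partial order, persistent
-- valuation).  Finiteness: an explicit complete list of nodes.

record Model (nv np : ℕ) : Set₁ where
  field
    W : Set
    _≼_ : W → W → Bool
    refl≼ : ∀ w → T (w ≼ w)
    trans≼ : ∀ u v w → T (u ≼ v) → T (v ≼ w) → T (u ≼ w)
    antisym≼ : ∀ u v → T (u ≼ v) → T (v ≼ u) → u ≡ v
    root : W
    root≼ : ∀ w → T (root ≼ w)
    V : W → Atom nv np → Bool
    persist : ∀ u v a → T (u ≼ v) → T (V u a) → T (V v a)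
    nodes : List W
    complete : ∀ w → w ∈ nodes

open Model

Forces : ∀ {nv np} (K : Model nv np) → W K → Fm nv np → Set
Forces K w (atm a) = T (V K w a)
Forces K w ⊥ᶠ = ⊥
Forces K w (A ∧ᶠ B) = Forces K w A × Forces K w B
Forces K w (A ∨ᶠ B) = Forces K w A ⊎ Forces K w B
Forces K w (A ⇒ᶠ B) = ∀ v → T (_≼_ K w v) → Forces K v A → Forces K v B

_⊩_ : ∀ {nv np} → Model nv np → Fm nv np → Set
K ⊩ A = Forces K (root K) A

Val : ∀ {nv np} → Model nv np → Atom nv np → Bool
Val K = V K (root K)

T-irr : ∀ b (p q : T b) → p ≡ q
T-irr true tt tt = refl

module _ {A : Set} (f : A → Bool) where
  pick : (x : A) (b : Bool) → f x ≡ b → List (Σ A (λ v → T (f v))) → List (Σ A (λ v → T (f v)))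
  pick x true eq rest = (x , subst T (sym eq) tt) ∷ rest
  pick x false eq rest = rest

  restrict : List A → List (Σ A (λ v → T (f v)))
  restrict [] = []
  restrict (x ∷ xs) = pick x (f x) refl (restrict xs)

  pick-here : ∀ x b (eq : f x ≡ b) rest (p : T (f x)) → (x , p) ∈ pick x b eq rest
  pick-here x true eq rest p = here (cong (x ,_) (T-irr (f x) p _))
  pick-here x false eq rest p = ⊥-elim (subst T eq p)

  pick-there : ∀ x b eq rest {y} → y ∈ rest → y ∈ pick x b eq rest
  pick-there x true eq rest m = there m
  pick-there x false eq rest m = m

  restrict-complete : ∀ xs x (p : T (f x)) → x ∈ xs → (x , p) ∈ restrict xs
  restrict-complete (y ∷ xs) .y p (here refl) = pick-here y (f y) refl _ p
  restrict-complete (y ∷ xs) x p (there m) = pick-there y (f y) refl _ (restrict-complete xs x p m)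

_↾_ : ∀ {nv np} (K : Model nv np) → W K → Model nv np
K ↾ w = record
  { W = Σ (W K) (λ v → T (_≼_ K w v))
  ; _≼_ = λ x y → _≼_ K (proj₁ x) (proj₁ y)
  ; refl≼ = λ x → refl≼ K (proj₁ x)
  ; trans≼ = λ x y z → trans≼ K (proj₁ x) (proj₁ y) (proj₁ z)
  ; antisym≼ = asym
  ; root = w , refl≼ K w
  ; root≼ = λ x → proj₂ x
  ; V = λ x → V K (proj₁ x)
  ; persist = λ x y a → persist K (proj₁ x) (proj₁ y) a
  ; nodes = restrict (_≼_ K w) (nodes K)
  ; complete = λ x → restrict-complete (_≼_ K w) (nodes K) (proj₁ x) (proj₂ x) (complete K (proj₁ x))
  }
  where
  asym : (x y : Σ (W K) (λ v → T (_≼_ K w v))) → T (_≼_ K (proj₁ x) (proj₁ y)) → T (_≼_ K (proj₁ y) (proj₁ x)) → x ≡ y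
  asym (u , p) (v , q) a b with antisym≼ K u v a b
  ... | refl = cong (u ,_) (T-irr _ p q)

-- ∑ M : disjoint union of a finite list of models with a fresh root
-- (empty valuation) below.

module _ {nv np : ℕ} where
  SumW : List (Model nv np) → Set
  SumW [] = ⊥
  SumW (M ∷ Ms) = W M ⊎ SumW Ms

  sle : ∀ Ms → SumW Ms → SumW Ms → Bool
  sle (M ∷ Ms) (inj₁ x) (inj₁ y) = _≼_ M x y
  sle (M ∷ Ms) (inj₁ x) (inj₂ y) = false
  sle (M ∷ Ms) (inj₂ x) (inj₁ y) = false
  sle (M ∷ Ms) (inj₂ x) (inj₂ y) = sle Ms x y

  srefl : ∀ Ms x → T (sle Ms x x)
  srefl (M ∷ Ms) (inj₁ x) = refl≼ M x
  srefl (M ∷ Ms) (inj₂ x) = srefl Ms x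

  strans : ∀ Ms x y z → T (sle Ms x y) → T (sle Ms y z) → T (sle Ms x z)
  strans (M ∷ Ms) (inj₁ x) (inj₁ y) (inj₁ z) p q = trans≼ M x y z p q
  strans (M ∷ Ms) (inj₁ x) (inj₁ y) (inj₂ z) p ()
  strans (M ∷ Ms) (inj₁ x) (inj₂ y) z () q
  strans (M ∷ Ms) (inj₂ x) (inj₁ y) z () q
  strans (M ∷ Ms) (inj₂ x) (inj₂ y) (inj₁ z) p ()
  strans (M ∷ Ms) (inj₂ x) (inj₂ y) (inj₂ z) p q = strans Ms x y z p q

  santi : ∀ Ms x y → T (sle Ms x y) → T (sle Ms y x) → x ≡ y
  santi (M ∷ Ms) (inj₁ x) (inj₁ y) p q = cong inj₁ (antisym≼ M x y p q)
  santi (M ∷ Ms) (inj₁ x) (inj₂ y) () q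
  santi (M ∷ Ms) (inj₂ x) (inj₁ y) () q
  santi (M ∷ Ms) (inj₂ x) (inj₂ y) p q = cong inj₂ (santi Ms x y p q)

  sV : ∀ Ms → SumW Ms → Atom nv np → Bool
  sV (M ∷ Ms) (inj₁ x) = V M x
  sV (M ∷ Ms) (inj₂ x) = sV Ms x

  spersist : ∀ Ms x y a → T (sle Ms x y) → T (sV Ms x a) → T (sV Ms y a)
  spersist (M ∷ Ms) (inj₁ x) (inj₁ y) a p h = persist M x y a p h
  spersist (M ∷ Ms) (inj₁ x) (inj₂ y) a () h
  spersist (M ∷ Ms) (inj₂ x) (inj₁ y) a () h
  spersist (M ∷ Ms) (inj₂ x) (inj₂ y) a p h = spersist Ms x y a p h

  snodes : ∀ Ms → List (SumW Ms)
  snodes [] = []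
  snodes (M ∷ Ms) = map inj₁ (nodes M) ++ map inj₂ (snodes Ms)

  scomplete : ∀ Ms x → x ∈ snodes Ms
  scomplete (M ∷ Ms) (inj₁ x) = ∈-++⁺ˡ (∈-map⁺ inj₁ (complete M x))
  scomplete (M ∷ Ms) (inj₂ x) = ∈-++⁺ʳ (map inj₁ (nodes M)) (∈-map⁺ inj₂ (scomplete Ms x))

  mle : ∀ Ms → Maybe (SumW Ms) → Maybe (SumW Ms) → Bool
  mle Ms nothing y = true
  mle Ms (just x) nothing = false
  mle Ms (just x) (just y) = sle Ms x y

  mrefl : ∀ Ms x → T (mle Ms x x)
  mrefl Ms nothing = tt
  mrefl Ms (just x) = srefl Ms x

  mtrans : ∀ Ms x y z → T (mle Ms x y) → T (mle Ms y z) → T (mle Ms x z)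
  mtrans Ms nothing y z p q = tt
  mtrans Ms (just x) nothing z () q
  mtrans Ms (just x) (just y) nothing p ()
  mtrans Ms (just x) (just y) (just z) p q = strans Ms x y z p q

  manti : ∀ Ms x y → T (mle Ms x y) → T (mle Ms y x) → x ≡ y
  manti Ms nothing nothing p q = refl
  manti Ms nothing (just y) p ()
  manti Ms (just x) nothing () q
  manti Ms (just x) (just y) p q = cong just (santi Ms x y p q)

  mV : ∀ Ms → Maybe (SumW Ms) → Atom nv np → Bool
  mV Ms nothing a = false
  mV Ms (just x) a = sV Ms x a

  mpersist : ∀ Ms x y a → T (mle Ms x y) → T (mV Ms x a) → T (mV Ms y a)
  mpersist Ms nothing y a p ()
  mpersist Ms (just x) nothing a () h
  mpersist Ms (just x) (just y) a p h = spersist Ms x y a p h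

  mcomplete : ∀ Ms x → x ∈ (nothing ∷ map just (snodes Ms))
  mcomplete Ms nothing = here refl
  mcomplete Ms (just x) = there (∈-map⁺ just (scomplete Ms x))

  ∑ : List (Model nv np) → Model nv np
  ∑ Ms = record
    { W = Maybe (SumW Ms)
    ; _≼_ = mle Ms
    ; refl≼ = mrefl Ms
    ; trans≼ = mtrans Ms
    ; antisym≼ = manti Ms
    ; root = nothing
    ; root≼ = λ _ → tt
    ; V = mV Ms
    ; persist = mpersist Ms
    ; nodes = nothing ∷ map just (snodes Ms)
    ; complete = mcomplete Ms
    }

-- Variants: same frame, same valuation at all non-root nodes, root
-- valuation replaced by X.  (The root is the unique node w with w ≼ root.)
-- The side condition is exactly what is needed for persistence.

VariantOK : ∀ {nv np} (K : Model nv np) → (Atom nv np → Bool) → Set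
VariantOK K X = ∀ w a → ¬ T (_≼_ K w (root K)) → T (X a) → T (V K w a)

variant : ∀ {nv np} (K : Model nv np) (X : Atom nv np → Bool) → VariantOK K X → Model nv np
variant K X ok = record
  { W = W K
  ; _≼_ = _≼_ K
  ; refl≼ = refl≼ K
  ; trans≼ = trans≼ K
  ; antisym≼ = antisym≼ K
  ; root = root K
  ; root≼ = root≼ K
  ; V = V'
  ; persist = pers
  ; nodes = nodes K
  ; complete = complete K
  }
  where
  V' : W K → Atom _ _ → Bool
  V' w a = if _≼_ K w (root K) then X a else V K w a
  pers : ∀ u v a → T (_≼_ K u v) → T (V' u a) → T (V' v a)
  pers u v a p h with _≼_ K u (root K) in eu | _≼_ K v (root K) in ev
  ... | true | true = h
  ... | true | false = ok v a (λ t → subst T ev t) h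
  ... | false | true = ⊥-elim (subst T eu (trans≼ K u v (root K) p (subst T (sym ev) tt)))
  ... | false | false = persist K u v a p h

-- X' is the root valuation of a par-variant of the model with root valuation X
SamePar : ∀ {nv np} → (Atom nv np → Bool) → (Atom nv np → Bool) → Set
SamePar {np = np} X X' = ∀ (p : Fin np) → X' (inj₂ p) ≡ X (inj₂ p)

_~[_]_ : ∀ {nv np} → Model nv np → ℕ → Model nv np → Set
K ~[ zero ] K' = ∀ a → Val K a ≡ Val K' a
K ~[ suc n ] K' =
  (∀ w → Σ (W K') (λ w' → (K ↾ w) ~[ n ] (K' ↾ w'))) ×
  (∀ w' → Σ (W K) (λ w → (K ↾ w) ~[ n ] (K' ↾ w')))

_≤[_]_ : ∀ {nv np} → Model nv np → ℕ → Model nv np → Set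
K ≤[ zero ] K' = ∀ a → T (Val K' a) → T (Val K a)
K ≤[ suc n ] K' = ∀ w → Σ (W K') (λ w' → (K ↾ w) ~[ n ] (K' ↾ w'))

Stable : ∀ {ℓ nv np} → (Model nv np → Set ℓ) → Set (Level.suc Level.zero ⊔ℓ ℓ)
Stable 𝒦 = ∀ K → 𝒦 K → ∀ w → 𝒦 (K ↾ w)

Extendable : ∀ {ℓ nv np} → Fm nv np → (Model nv np → Set ℓ) → Set (Level.suc Level.zero ⊔ℓ ℓ)
Extendable {nv = nv} {np} E 𝒦 =
  (∀ K → 𝒦 K → ∀ w → Forces K w E) ×
  (∀ (Ms : List (Model nv np)) → All 𝒦 Ms →
     ∀ (X : Atom nv np → Bool) (ok : VariantOK (∑ Ms) X) → variant (∑ Ms) X ok ⊩ E →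
     Σ (Atom nv np → Bool) (λ X' → Σ (VariantOK (∑ Ms) X') (λ ok' →
        SamePar X X' × 𝒦 (variant (∑ Ms) X' ok'))))

Down : ∀ {ℓ nv np} → (Model nv np → Set ℓ) → ℕ → Model nv np → Set (Level.suc Level.zero ⊔ℓ ℓ)
Down {nv = nv} {np} 𝒦 n K = Σ (Model nv np) (λ K' → 𝒦 K' × K ≤[ n ] K')

module Submission where

open import Defs
open import Level using (Level)
open import Data.Nat using (ℕ; zero; suc; _<_; _≤_; s≤s)
open import Data.Nat.Properties using (≤-refl; <⇒≤; m⊔n≤o⇒m≤o; m⊔n≤o⇒n≤o)
open import Data.Product using (Σ; _×_; _,_; proj₁; proj₂)
open import Data.Sum using (inj₁; inj₂)
open import Data.Bool using (Bool; true; false; T)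
open import Data.Unit using (tt)
open import Data.Empty using (⊥-elim)
open import Data.Maybe using (nothing; just)
open import Data.List using (List; []; _∷_; _++_; map)
open import Data.List.Membership.Propositional using (_∈_)
open import Data.List.Membership.Propositional.Properties using (∈-++⁺ˡ; ∈-++⁺ʳ; ∈-++⁻; ∈-map⁺; ∈-map⁻)
open import Data.List.Relation.Unary.Any using (here; there)
open import Data.List.Relation.Unary.All using (All; []; _∷_; lookup; tabulate)
open import Relation.Binary.PropositionalEquality using (_≡_; refl; sym; trans; cong; subst)

-- If K ≤ₙ₊₁ K' with K' ∈ 𝒦, every node w of K is n-bisimilar to a node w' of K',
-- and the cone K'_{w'} lies in 𝒦 by stability.  For ℳ ⊆ 𝒦↓ₙ replace ∑ℳ by the sum
-- of all these cones, one per node of a summand.  Under the same root valuation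
-- the two roots are n-bisimilar, so as c(E) ≤ n the sum of cones forces E as well;
-- E-extendability of 𝒦 then gives a par-variant of it in 𝒦, and the variant of ∑ℳ
-- with the same root valuation lies ≤ₙ₊₁ below it.

open Model

T-ext : ∀ {a b : Bool} → (T a → T b) → (T b → T a) → a ≡ b
T-ext {false} {false} _ _ = refl
T-ext {false} {true}  _ g = ⊥-elim (g tt)
T-ext {true}  {false} f _ = ⊥-elim (f tt)
T-ext {true}  {true}  _ _ = refl

module _ {nv np : ℕ} where

  private
    Mod = Model nv np

  -- K_x ∼ₖ L_y, phrased on the nodes themselves instead of generated submodels.
  Bisim : ℕ → (K : Mod) → W K → (L : Mod) → W L → Set
  Bisim zero    K x L y = ∀ a → V K x a ≡ V L y a
  Bisim (suc k) K x L y =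
    (∀ x' → T (_≼_ K x x') → Σ (W L) (λ y' → T (_≼_ L y y') × Bisim k K x' L y')) ×
    (∀ y' → T (_≼_ L y y') → Σ (W K) (λ x' → T (_≼_ K x x') × Bisim k K x' L y'))

  Bisim-sym : ∀ k {K x L y} → Bisim k K x L y → Bisim k L y K x
  Bisim-sym zero    r a = sym (r a)
  Bisim-sym (suc k) (forth , back) =
    (λ y' q → let (x' , p , r) = back y' q in x' , p , Bisim-sym k r) ,
    (λ x' p → let (y' , q , r) = forth x' p in y' , q , Bisim-sym k r)

  Bisim⇒V⊇ : ∀ k {K x L y} → Bisim k K x L y → ∀ a → T (V L y a) → T (V K x a)
  Bisim⇒V⊇ zero    r a h = subst T (sym (r a)) h
  Bisim⇒V⊇ (suc k) {K} {x} {L} {y} (forth , _) a h =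
    let (y' , q , r) = forth x (refl≼ K x) in Bisim⇒V⊇ k r a (persist L y y' a q h)

  Bisim⇒V≡ : ∀ k {K x L y} → Bisim k K x L y → ∀ a → V K x a ≡ V L y a
  Bisim⇒V≡ k r a = T-ext (Bisim⇒V⊇ k (Bisim-sym k r) a) (Bisim⇒V⊇ k r a)

  Bisim-≤ : ∀ {j k K x L y} → j ≤ k → Bisim k K x L y → Bisim j K x L y
  Bisim-≤ {zero}  {k} _ r = Bisim⇒V≡ k r
  Bisim-≤ {suc j} {suc k} (s≤s j≤k) (forth , back) =
    (λ x' p → let (y' , q , r) = forth x' p in y' , q , Bisim-≤ j≤k r) ,
    (λ y' q → let (x' , p , r) = back y' q in x' , p , Bisim-≤ j≤k r)

  Bisim⇒Forces : ∀ (A : Fm nv np) {m K x L y} → c A ≤ m → Bisim m K x L y →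
    Forces K x A → Forces L y A
  Bisim⇒Forces (atm a) {m} _ r h = subst T (Bisim⇒V≡ m r a) h
  Bisim⇒Forces ⊥ᶠ _ _ ()
  Bisim⇒Forces (A ∧ᶠ B) cA∧B≤m r (hA , hB) =
    Bisim⇒Forces A (m⊔n≤o⇒m≤o (c A) (c B) cA∧B≤m) r hA ,
    Bisim⇒Forces B (m⊔n≤o⇒n≤o (c A) (c B) cA∧B≤m) r hB
  Bisim⇒Forces (A ∨ᶠ B) cA∨B≤m r (inj₁ hA) = inj₁ (Bisim⇒Forces A (m⊔n≤o⇒m≤o (c A) (c B) cA∨B≤m) r hA)
  Bisim⇒Forces (A ∨ᶠ B) cA∨B≤m r (inj₂ hB) = inj₂ (Bisim⇒Forces B (m⊔n≤o⇒n≤o (c A) (c B) cA∨B≤m) r hB)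
  Bisim⇒Forces (A ⇒ᶠ B) {suc k} (s≤s cA⊔cB≤k) (_ , back) h y' q hA =
    let (x' , p , r) = back y' q in
    Bisim⇒Forces B (m⊔n≤o⇒n≤o (c A) (c B) cA⊔cB≤k) r
      (h x' p (Bisim⇒Forces A (m⊔n≤o⇒m≤o (c A) (c B) cA⊔cB≤k) (Bisim-sym k r) hA))

  record _↪_ (M K : Mod) : Set where
    field
      emb       : W M → W K
      ≼-mono    : ∀ u v → T (_≼_ M u v) → T (_≼_ K (emb u) (emb v))
      ≼-reflect : ∀ u v → T (_≼_ K (emb u) (emb v)) → T (_≼_ M u v)
      upward    : ∀ u z → T (_≼_ K (emb u) z) → Σ (W M) (λ v → emb v ≡ z)
      V-emb     : ∀ u a → V K (emb u) a ≡ V M u a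
  open _↪_

  Bisim-↪ˡ : ∀ k {M K} (ι : M ↪ K) {u L y} → Bisim k M u L y → Bisim k K (emb ι u) L y
  Bisim-↪ˡ zero    ι {u} r a = trans (V-emb ι u a) (r a)
  Bisim-↪ˡ (suc k) {M} {K} ι {u} {L} {y} (forth , back) = forth' , back'
    where
    forth' : ∀ z → T (_≼_ K (emb ι u) z) → Σ (W L) (λ y' → T (_≼_ L y y') × Bisim k K z L y')
    forth' z p with upward ι u z p
    ... | v , refl = let (y' , q , r) = forth v (≼-reflect ι u v p) in y' , q , Bisim-↪ˡ k ι r
    back' : ∀ y' → T (_≼_ L y y') → Σ (W K) (λ z → T (_≼_ K (emb ι u) z) × Bisim k K z L y')
    back' y' q = let (v , p , r) = back y' q in emb ι v , ≼-mono ι u v p , Bisim-↪ˡ k ι r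

  Bisim-↪ˡ⁻ : ∀ k {M K} (ι : M ↪ K) {u L y} → Bisim k K (emb ι u) L y → Bisim k M u L y
  Bisim-↪ˡ⁻ zero    ι {u} r a = trans (sym (V-emb ι u a)) (r a)
  Bisim-↪ˡ⁻ (suc k) {M} {K} ι {u} {L} {y} (forth , back) = forth' , back'
    where
    forth' : ∀ v → T (_≼_ M u v) → Σ (W L) (λ y' → T (_≼_ L y y') × Bisim k M v L y')
    forth' v p = let (y' , q , r) = forth (emb ι v) (≼-mono ι u v p) in y' , q , Bisim-↪ˡ⁻ k ι r
    pull : ∀ {y'} z → T (_≼_ K (emb ι u) z) → Bisim k K z L y' →
      Σ (W M) (λ v → T (_≼_ M u v) × Bisim k M v L y')
    pull z p r with upward ι u z p
    ... | v , refl = v , ≼-reflect ι u v p , Bisim-↪ˡ⁻ k ι r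
    back' : ∀ y' → T (_≼_ L y y') → Σ (W M) (λ v → T (_≼_ M u v) × Bisim k M v L y')
    back' y' q = let (z , p , r) = back y' q in pull z p r

  Bisim-↪ʳ⁻ : ∀ k {N L} (κ : N ↪ L) {K x v} → Bisim k K x L (emb κ v) → Bisim k K x N v
  Bisim-↪ʳ⁻ k κ r = Bisim-sym k (Bisim-↪ˡ⁻ k κ (Bisim-sym k r))

  Bisim-↪ : ∀ k {M K N L} (ι : M ↪ K) (κ : N ↪ L) {u v} →
    Bisim k M u N v → Bisim k K (emb ι u) L (emb κ v)
  Bisim-↪ k ι κ r = Bisim-sym k (Bisim-↪ˡ k κ (Bisim-sym k (Bisim-↪ˡ k ι r)))

  Bisim-↪⁻ : ∀ k {M K N L} (ι : M ↪ K) (κ : N ↪ L) {u v} →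
    Bisim k K (emb ι u) L (emb κ v) → Bisim k M u N v
  Bisim-↪⁻ k ι κ r = Bisim-↪ʳ⁻ k κ (Bisim-↪ˡ⁻ k ι r)

  ↾-↪ : (K : Mod) (w : W K) → (K ↾ w) ↪ K
  ↾-↪ K w = record
    { emb       = proj₁
    ; ≼-mono    = λ _ _ p → p
    ; ≼-reflect = λ _ _ p → p
    ; upward    = λ u z q → (z , trans≼ K w (proj₁ u) z (proj₂ u) q) , refl
    ; V-emb     = λ _ _ → refl
    }

  ~⇒Bisim : ∀ k {K x L y} → (K ↾ x) ~[ k ] (L ↾ y) → Bisim k K x L y
  ~⇒Bisim zero    h = h
  ~⇒Bisim (suc k) {K} {x} {L} {y} (forth , back) =
    (λ x' p → let ((y' , q) , h) = forth (x' , p) in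
       y' , q , Bisim-↪ k (↾-↪ K x) (↾-↪ L y) (~⇒Bisim k h)) ,
    (λ y' q → let ((x' , p) , h) = back (y' , q) in
       x' , p , Bisim-↪ k (↾-↪ K x) (↾-↪ L y) (~⇒Bisim k h))

  Bisim⇒~ : ∀ k {K x L y} → Bisim k K x L y → (K ↾ x) ~[ k ] (L ↾ y)
  Bisim⇒~ zero    r = r
  Bisim⇒~ (suc k) {K} {x} {L} {y} (forth , back) =
    (λ (x' , p) → let (y' , q , r) = forth x' p in
       (y' , q) , Bisim⇒~ k (Bisim-↪⁻ k (↾-↪ K x) (↾-↪ L y) r)) ,
    (λ (y' , q) → let (x' , p , r) = back y' q in
       (x' , p) , Bisim⇒~ k (Bisim-↪⁻ k (↾-↪ K x) (↾-↪ L y) r))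

  ≤-↾ : ∀ {m K K'} → K ≤[ suc m ] K' → ∀ w → (K ↾ w) ≤[ suc m ] K'
  ≤-↾ {m} {K} {K'} K≤K' w (v , _) =
    let (v' , h) = K≤K' v in v' , Bisim⇒~ m (Bisim-↪ˡ⁻ m (↾-↪ K w) (~⇒Bisim m {K} {v} {K'} {v'} h))

  ≤⇒Forces : ∀ (A : Fm nv np) {m K K'} → c A ≤ m → K ≤[ suc m ] K' →
    (∀ w' → Forces K' w' A) → ∀ w → Forces K w A
  ≤⇒Forces A {m} cA≤m K≤K' K'⊩A w =
    let (w' , h) = K≤K' w in Bisim⇒Forces A cA≤m (Bisim-sym m (~⇒Bisim m h)) (K'⊩A w')

  summandNode : ∀ {M : Mod} {Ms} → M ∈ Ms → W M → SumW Ms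
  summandNode (here refl) u = inj₁ u
  summandNode (there p)   u = inj₂ (summandNode p u)

  summand-≼ : ∀ {M : Mod} {Ms} (p : M ∈ Ms) u v → sle Ms (summandNode p u) (summandNode p v) ≡ _≼_ M u v
  summand-≼ (here refl) u v = refl
  summand-≼ (there p)   u v = summand-≼ p u v

  summand-V : ∀ {M : Mod} {Ms} (p : M ∈ Ms) u a → sV Ms (summandNode p u) a ≡ V M u a
  summand-V (here refl) u a = refl
  summand-V (there p)   u a = summand-V p u a

  summand-upward : ∀ {M : Mod} {Ms} (p : M ∈ Ms) u z → T (sle Ms (summandNode p u) z) →
    Σ (W M) (λ v → summandNode p v ≡ z)
  summand-upward (here refl) u (inj₁ v) _ = v , refl
  summand-upward (there p)   u (inj₂ z) q with summand-upward p u z q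
  ... | v , refl = v , refl

  data SumNode (Ms : List Mod) : SumW Ms → Set₁ where
    node : ∀ {M} (p : M ∈ Ms) (u : W M) → SumNode Ms (summandNode p u)

  sumNode : ∀ Ms (z : SumW Ms) → SumNode Ms z
  sumNode (M ∷ Ms) (inj₁ u) = node (here refl) u
  sumNode (M ∷ Ms) (inj₂ z) with sumNode Ms z
  ... | node p u = node (there p) u

  summand-↪ : ∀ {M : Mod} {Ms} (p : M ∈ Ms) X ok → M ↪ variant (∑ Ms) X ok
  summand-↪ {M} {Ms} p X ok = record
    { emb       = λ u → just (summandNode p u)
    ; ≼-mono    = λ u v q → subst T (sym (summand-≼ p u v)) q
    ; ≼-reflect = λ u v q → subst T (summand-≼ p u v) q
    ; upward    = upward'
    ; V-emb     = summand-V p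
    }
    where
    upward' : ∀ u z → T (mle Ms (just (summandNode p u)) z) → Σ (W M) (λ v → just (summandNode p v) ≡ z)
    upward' u (just z) q = let (v , eq) = summand-upward p u z q in v , cong just eq

  _⊆_ : (X Y : Atom nv np → Bool) → Set
  X ⊆ Y = ∀ a → T (X a) → T (Y a)

  ⊆Val⇒VariantOK-∑ : ∀ Ms {X} → (∀ {M} → M ∈ Ms → X ⊆ Val M) → VariantOK (∑ Ms) X
  ⊆Val⇒VariantOK-∑ Ms X⊆ nothing  a nonroot _ = ⊥-elim (nonroot tt)
  ⊆Val⇒VariantOK-∑ Ms X⊆ (just z) a _ h with sumNode Ms z
  ... | node {M} p u = subst T (sym (summand-V p u a)) (persist M (root M) u a (root≼ M u) (X⊆ p a h))

  VariantOK-∑⇒⊆V : ∀ {Ms X} → VariantOK (∑ Ms) X → ∀ {M} → M ∈ Ms → ∀ u → X ⊆ V M u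
  VariantOK-∑⇒⊆V ok p u a h = subst T (summand-V p u a) (ok (just (summandNode p u)) a (λ ()) h)

  -- The back direction is needed only below depth m: at depth j the back clause
  -- of the roots asks for depth j − 1.
  module SumMatching {Ms Ns : List Mod} {X : Atom nv np → Bool}
      (okK : VariantOK (∑ Ms) X) (okL : VariantOK (∑ Ns) X) (m : ℕ)
      (forth : ∀ z → Σ (SumW Ns) (λ z' →
         Bisim m (variant (∑ Ms) X okK) (just z) (variant (∑ Ns) X okL) (just z')))
      (back : ∀ z' i → suc i ≤ m → Σ (SumW Ms) (λ z →
         Bisim i (variant (∑ Ms) X okK) (just z) (variant (∑ Ns) X okL) (just z')))
      where

    private
      K = variant (∑ Ms) X okK
      L = variant (∑ Ns) X okL

    root-Bisim : ∀ j → j ≤ m → Bisim j K nothing L nothing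
    root-Bisim zero    _   a = refl
    root-Bisim (suc j) j<m = forth' , back'
      where
      j≤m : j ≤ m
      j≤m = <⇒≤ j<m
      forth' : ∀ x → T (mle Ms nothing x) → Σ (W L) (λ y → T (mle Ns nothing y) × Bisim j K x L y)
      forth' nothing  _ = nothing , tt , root-Bisim j j≤m
      forth' (just z) _ = let (z' , r) = forth z in just z' , tt , Bisim-≤ j≤m r
      back' : ∀ y → T (mle Ns nothing y) → Σ (W K) (λ x → T (mle Ms nothing x) × Bisim j K x L y)
      back' nothing   _ = nothing , tt , root-Bisim j j≤m
      back' (just z') _ = let (z , r) = back z' j j<m in just z , tt , r

    ≤-∑ : K ≤[ suc m ] L
    ≤-∑ nothing  = nothing , Bisim⇒~ m (root-Bisim m ≤-refl)
    ≤-∑ (just z) = let (z' , r) = forth z in just z' , Bisim⇒~ m r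

module _ {ℓ : Level} {nv np : ℕ} (𝒦 : Model nv np → Set ℓ) (m : ℕ) where

  private
    D = Down 𝒦 (suc m)

  Down-stable : Stable D
  Down-stable K (K' , K'∈𝒦 , K≤K') w = K' , K'∈𝒦 , ≤-↾ {m = m} {K} {K'} K≤K' w

  Down-Forces : ∀ E → c E ≤ m → (∀ K → 𝒦 K → ∀ w → Forces K w E) → ∀ K → D K → ∀ w → Forces K w E
  Down-Forces E cE≤m 𝒦⊩E K (K' , K'∈𝒦 , K≤K') = ≤⇒Forces E cE≤m K≤K' (𝒦⊩E K' K'∈𝒦)

  cover : ∀ M → D M → W M → Model nv np
  cover M (K' , _ , M≤K') u = K' ↾ proj₁ (M≤K' u)

  Bisim-cover : ∀ M (d : D M) u → Bisim m M u (cover M d u) (root (cover M d u))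
  Bisim-cover M (K' , _ , M≤K') u =
    let (u' , h) = M≤K' u in Bisim-↪ʳ⁻ m (↾-↪ K' u') (~⇒Bisim m {M} {u} {K'} {u'} h)

  covers : ∀ Ms → All D Ms → List (Model nv np)
  covers []       []       = []
  covers (M ∷ Ms) (d ∷ ds) = map (cover M d) (nodes M) ++ covers Ms ds

  data IsCover {Ms} (ds : All D Ms) : Model nv np → Set₁ where
    cover-of : ∀ {M} (p : M ∈ Ms) (u : W M) → IsCover ds (cover M (lookup ds p) u)

  ∈-covers⁺ : ∀ {Ms} (ds : All D Ms) {M} (p : M ∈ Ms) u → cover M (lookup ds p) u ∈ covers Ms ds
  ∈-covers⁺ {M ∷ _} (d ∷ _)  (here refl) u = ∈-++⁺ˡ (∈-map⁺ (cover M d) (complete M u))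
  ∈-covers⁺ {M ∷ _} (d ∷ ds) (there p)   u = ∈-++⁺ʳ (map (cover M d) (nodes M)) (∈-covers⁺ ds p u)

  ∈-covers⁻ : ∀ {Ms} (ds : All D Ms) {N} → N ∈ covers Ms ds → IsCover ds N
  ∈-covers⁻ {M ∷ Ms} (d ∷ ds) q with ∈-++⁻ (map (cover M d) (nodes M)) q
  ... | inj₁ q' with ∈-map⁻ (cover M d) q'
  ...   | u , _ , refl = cover-of (here refl) u
  ∈-covers⁻ {M ∷ Ms} (d ∷ ds) q | inj₂ q' with ∈-covers⁻ ds q'
  ...   | cover-of p u = cover-of (there p) u

  covers∈𝒦 : Stable 𝒦 → ∀ {Ms} (ds : All D Ms) → All 𝒦 (covers Ms ds)
  covers∈𝒦 𝒦-stable ds = tabulate λ q → in𝒦 (∈-covers⁻ ds q)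
    where
    in𝒦 : ∀ {N} → IsCover ds N → 𝒦 N
    in𝒦 (cover-of p u) with lookup ds p
    ... | K' , K'∈𝒦 , M≤K' = 𝒦-stable K' K'∈𝒦 (proj₁ (M≤K' u))

  module _ {Ms} (ds : All D Ms) {X : Atom nv np → Bool} where

    VariantOK-covers : VariantOK (∑ Ms) X → VariantOK (∑ (covers Ms ds)) X
    VariantOK-covers ok = ⊆Val⇒VariantOK-∑ (covers Ms ds) λ q → X⊆ (∈-covers⁻ ds q)
      where
      X⊆ : ∀ {N} → IsCover ds N → X ⊆ Val N
      X⊆ (cover-of {M} p u) a h =
        subst T (Bisim⇒V≡ m (Bisim-cover M (lookup ds p) u) a) (VariantOK-∑⇒⊆V ok p u a h)

    VariantOK-uncovers : VariantOK (∑ (covers Ms ds)) X → VariantOK (∑ Ms) X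
    VariantOK-uncovers ok = ⊆Val⇒VariantOK-∑ Ms λ {M} p a h →
      let d = lookup ds p in
      subst T (sym (Bisim⇒V≡ m (Bisim-cover M d (root M)) a))
        (VariantOK-∑⇒⊆V ok (∈-covers⁺ ds p (root M)) (root (cover M d (root M))) a h)

    module _ (okK : VariantOK (∑ Ms) X) (okL : VariantOK (∑ (covers Ms ds)) X) where

      private
        K = variant (∑ Ms) X okK
        L = variant (∑ (covers Ms ds)) X okL

      forth-covers : ∀ z → Σ (SumW (covers Ms ds)) (λ z' → Bisim m K (just z) L (just z'))
      forth-covers z with sumNode Ms z
      ... | node {M} p u =
        let q = ∈-covers⁺ ds p u in
        summandNode q (root (cover M (lookup ds p) u)) ,
        Bisim-↪ m (summand-↪ p X okK) (summand-↪ q X okL) (Bisim-cover M (lookup ds p) u)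

      -- A node x of a cone lies above its root, so the back clause of
      -- Bisim-cover (at depth m, hence at every depth i+1 ≤ m) matches it.
      back-covers : ∀ z' i → suc i ≤ m → Σ (SumW Ms) (λ z → Bisim i K (just z) L (just z'))
      back-covers z' i i<m with sumNode (covers Ms ds) z'
      ... | node q x with ∈-covers⁻ ds q
      ...   | cover-of {M} p u =
        let d = lookup ds p
            (v , _ , r) = proj₂ (Bisim-≤ i<m (Bisim-cover M d u)) x (root≼ (cover M d u) x)
        in summandNode p v , Bisim-↪ i (summand-↪ p X okK) (summand-↪ q X okL) r

      open SumMatching okK okL m forth-covers back-covers public

  Down-extends : ∀ E → c E ≤ m → Stable 𝒦 → Extendable E 𝒦 → Extendable E D
  Down-extends E cE≤m 𝒦-stable (𝒦⊩E , 𝒦-ext) =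
    Down-Forces E cE≤m 𝒦⊩E , extend
    where
    extend : ∀ Ms → All D Ms → ∀ X (ok : VariantOK (∑ Ms) X) → variant (∑ Ms) X ok ⊩ E →
      Σ (Atom nv np → Bool) (λ X' → Σ (VariantOK (∑ Ms) X') (λ ok' → SamePar X X' × D (variant (∑ Ms) X' ok')))
    extend Ms ds X ok ∑Ms⊩E =
      let okL = VariantOK-covers ds ok
          ∑covers⊩E = Bisim⇒Forces E cE≤m (root-Bisim ds ok okL m ≤-refl) ∑Ms⊩E
          (X' , okL' , samePar , L'∈𝒦) = 𝒦-ext (covers Ms ds) (covers∈𝒦 𝒦-stable ds) X okL ∑covers⊩E
          okK' = VariantOK-uncovers ds okL'
      in X' , okK' , samePar , (variant (∑ (covers Ms ds)) X' okL' , L'∈𝒦 , ≤-∑ ds okK' okL')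

lemma5p3 : ∀ {ℓ : Level} {nv np : ℕ} (E : Fm nv np) → InLPar E →
    (𝒦 : Model nv np → Set ℓ) → Stable 𝒦 → Extendable E 𝒦 →
    ∀ (n : ℕ) → c E < n → Stable (Down 𝒦 n) × Extendable E (Down 𝒦 n)
lemma5p3 E _ 𝒦 𝒦-stable 𝒦-ext (suc m) (s≤s cE≤m) =
  Down-stable 𝒦 m , Down-extends 𝒦 m E cE≤m 𝒦-stable 𝒦-ext
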